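{- Let $\sigma$ be any subsequence (possibly empty) of $e\,w_l\,w_r\,c$. The Gentzen system $\mathcal{FL}_\sigma$ is equivalent to its external system $\mathbf{e}\mathcal{FL}_\sigma$: there exist translations $\tau'$ from $\mathcal{L}$-sequents to finite sets of $\mathcal{L}$-formulas and $\rho'$ from $\mathcal{L}$-formulas to finite sets of $\mathcal{L}$-sequents, each given by a schema in variables (so commuting with substitutions), such that for every set $\Gamma\cup\{\varphi\}$ of formulas, $\Gamma\vdash_{\mathbf{e}\mathcal{FL}_\sigma}\varphi$ iff $\rho'[\Gamma]\vdash_{\mathcal{FL}_\sigma}\rho'(\varphi)$, and for every sequent $\varsigma$, $\varsigma$ and $\rho'(\tau'(\varsigma))$ are interderivable in $\mathcal{FL}_\sigma$.
   Context: Let $\mathcal{L}$ be the propositional language with binary connectives $\vee,\wedge,*,\backslash,/$, unary connectives $\neg_r$ (right negation) and $\neg_l$ (left negation), and constants $0,1$; formulas are built from a countably infinite set of variables. A sequent is $\Gamma\Rightarrow\Delta$ with $\Gamma$ a finite (possibly empty) sequence of formulas and $\Delta$ a sequence of at most one formula ($\emptyset$ = empty sequence). The calculus $\mathbf{FL}$ has axioms $\varphi\Rightarrow\varphi$, $0\Rightarrow\emptyset$, $\emptyset\Rightarrow 1$ and rules ($\Gamma,\Pi,\Sigma$ finite sequences, $\Delta$ of length $\le1$): (Cut) from $\Gamma\Rightarrow\varphi$ and $\Sigma,\varphi,\Pi\Rightarrow\Delta$ infer $\Sigma,\Gamma,\Pi\Rightarrow\Delta$; ($\vee\Rightarrow$)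 from $\Sigma,\varphi,\Gamma\Rightarrow\Delta$ and $\Sigma,\psi,\Gamma\Rightarrow\Delta$ infer $\Sigma,\varphi\vee\psi,\Gamma\Rightarrow\Delta$; ($\Rightarrow\vee$) from $\Gamma\Rightarrow\varphi$ infer $\Gamma\Rightarrow\varphi\vee\psi$ and $\Gamma\Rightarrow\psi\vee\varphi$; ($\wedge\Rightarrow$) from $\Sigma,\varphi,\Gamma\Rightarrow\Delta$ infer $\Sigma,\varphi\wedge\psi,\Gamma\Rightarrow\Delta$ and $\Sigma,\psi\wedge\varphi,\Gamma\Rightarrow\Delta$; ($\Rightarrow\wedge$) from $\Gamma\Rightarrow\varphi$ and $\Gamma\Rightarrow\psi$ infer $\Gamma\Rightarrow\varphi\wedge\psi$; ($*\Rightarrow$) from $\Sigma,\varphi,\psi,\Gamma\Rightarrow\Delta$ infer $\Sigma,\varphi*\psi,\Gamma\Rightarrow\Delta$; ($\Rightarrow*$) from $\Gamma\Rightarrow\varphi$ and $\Pi\Rightarrow\psi$ infer $\Gamma,\Pi\Rightarrow\varphi*\psi$; ($\backslash\Rightarrow$) from $\Gamma\Rightarrow\varphi$ and $\Sigma,\psi,\Pi\Rightarrow\Delta$ infer $\Sigma,\Gamma,\varphi\backslash\psi,\Pi\Rightarrow\Delta$; ($\Rightarrow\backslash$) from $\varphi,\Gamma\Rightarrow\psi$ infer $\Gamma\Rightarrow\varphi\backslash\psi$; ($/\Rightarrow$) from $\Gamma\Rightarrow\varphi$ and $\Sigma,\psi,\Pi\Rightarrow\Delta$ infer $\Sigma,\psi/\varphi,\Gamma,\Pi\Rightarrow\Delta$;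 ($\Rightarrow/$) from $\Gamma,\varphi\Rightarrow\psi$ infer $\Gamma\Rightarrow\psi/\varphi$; ($\neg_r\Rightarrow$) from $\Gamma\Rightarrow\varphi$ infer $\Gamma,\neg_r\varphi\Rightarrow\emptyset$; ($\Rightarrow\neg_r$) from $\varphi,\Gamma\Rightarrow\emptyset$ infer $\Gamma\Rightarrow\neg_r\varphi$; ($\neg_l\Rightarrow$) from $\Gamma\Rightarrow\varphi$ infer $\neg_l\varphi,\Gamma\Rightarrow\emptyset$; ($\Rightarrow\neg_l$) from $\Gamma,\varphi\Rightarrow\emptyset$ infer $\Gamma\Rightarrow\neg_l\varphi$; ($1\Rightarrow$) from $\Sigma,\Gamma\Rightarrow\Delta$ infer $\Sigma,1,\Gamma\Rightarrow\Delta$; ($\Rightarrow0$) from $\Gamma\Rightarrow\emptyset$ infer $\Gamma\Rightarrow0$. For a subsequence $\sigma$ of $e\,w_l\,w_r\,c$, $\mathbf{FL}_\sigma$ adds the rules coded by the letters of $\sigma$: $e$: from $\Gamma,\varphi,\psi,\Pi\Rightarrow\Delta$ infer $\Gamma,\psi,\varphi,\Pi\Rightarrow\Delta$; $w_l$: from $\Sigma,\Gamma\Rightarrow\Delta$ infer $\Sigma,\varphi,\Gamma\Rightarrow\Delta$; $w_r$: from $\Gamma\Rightarrow\emptyset$ infer $\Gamma\Rightarrow\varphi$; $c$: from $\Sigma,\varphi,\varphi,\Gamma\Rightarrow\Delta$ infer $\Sigma,\varphi,\Gamma\Rightarrow\Delta$. The Gentzen system $\mathcal{FL}_\sigma$: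 $\Phi\vdash\varsigma$ iff there is a finite sequence of sequents ending in $\varsigma$, each an instance of an axiom, a member of $\Phi$, or obtained from earlier ones by an instance of a rule of $\mathbf{FL}_\sigma$. Its external system $\mathbf{e}\mathcal{FL}_\sigma$ is the Hilbert system on formulas with $\Sigma\vdash\varphi$ iff $\{\emptyset\Rightarrow\psi:\psi\in\Sigma\}\vdash_{\mathcal{FL}_\sigma}\emptyset\Rightarrow\varphi$. -}

module Defs where

open import Data.Nat using (ℕ; suc)
open import Data.Fin using (Fin; zero; suc)
open import Data.Bool using (Bool; T)
open import Data.Maybe using (Maybe; just; nothing)
open import Data.List using (List; []; _∷_; _++_; map; length; lookup; concatMap)
open import Data.List.Membership.Propositional using (_∈_)
open import Data.Product using (Σ; _×_)
open import Data.Unit using (⊤)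
open import Relation.Binary.PropositionalEquality using (_≡_)

-- Formulas of the language L, over a type V of variables.
-- The language L itself is  Fm ℕ  (countably many variables).
infixr 30 _⊛_
infixr 25 _⋀_
infixr 20 _⋁_
infixr 28 _╲_
infixl 28 _╱_

data Fm (V : Set) : Set where
  var  : V → Fm V
  _⋁_  : Fm V → Fm V → Fm V
  _⋀_  : Fm V → Fm V → Fm V
  _⊛_  : Fm V → Fm V → Fm V
  _╲_  : Fm V → Fm V → Fm V
  _╱_  : Fm V → Fm V → Fm V
  ¬r   : Fm V → Fm V
  ¬l   : Fm V → Fm V
  𝟘    : Fm V
  𝟙    : Fm V

_⟪_⟫ : {V W : Set} → Fm V → (V → Fm W) → Fm W
var x   ⟪ s ⟫ = s x
(a ⋁ b) ⟪ s ⟫ = (a ⟪ s ⟫) ⋁ (b ⟪ s ⟫)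
(a ⋀ b) ⟪ s ⟫ = (a ⟪ s ⟫) ⋀ (b ⟪ s ⟫)
(a ⊛ b) ⟪ s ⟫ = (a ⟪ s ⟫) ⊛ (b ⟪ s ⟫)
(a ╲ b) ⟪ s ⟫ = (a ⟪ s ⟫) ╲ (b ⟪ s ⟫)
(a ╱ b) ⟪ s ⟫ = (a ⟪ s ⟫) ╱ (b ⟪ s ⟫)
¬r a    ⟪ s ⟫ = ¬r (a ⟪ s ⟫)
¬l a    ⟪ s ⟫ = ¬l (a ⟪ s ⟫)
𝟘       ⟪ s ⟫ = 𝟘
𝟙       ⟪ s ⟫ = 𝟙

-- Sequents Γ ⇒ Δ, Γ a finite sequence, Δ of length ≤ 1 (nothing = ∅).
infix 3 _⇒_
record Seq (V : Set) : Set where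
  constructor _⇒_
  field
    ant : List (Fm V)
    succ : Maybe (Fm V)

substSeq : {V W : Set} → Seq V → (V → Fm W) → Seq W
substSeq (Γ ⇒ nothing) s = map (_⟪ s ⟫) Γ ⇒ nothing
substSeq (Γ ⇒ just φ)  s = map (_⟪ s ⟫) Γ ⇒ just (φ ⟪ s ⟫)

-- A subsequence σ of  e w_l w_r c  is determined by which letters occur.
record Subseq : Set where
  field
    e wl wr c : Bool
open Subseq public

data Der (σ : Subseq) (Φ : Seq ℕ → Set) : Seq ℕ → Set where
  ax   : ∀ {φ} → Der σ Φ (φ ∷ [] ⇒ just φ)
  ax0  : Der σ Φ (𝟘 ∷ [] ⇒ nothing)
  ax1  : Der σ Φ ([] ⇒ just 𝟙)
  hyp  : ∀ {ς} → Φ ς → Der σ Φ ς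
  cut  : ∀ {Γ Σ' Π Δ φ} → Der σ Φ (Γ ⇒ just φ) → Der σ Φ (Σ' ++ φ ∷ Π ⇒ Δ)
         → Der σ Φ (Σ' ++ Γ ++ Π ⇒ Δ)
  ∨L   : ∀ {Σ' Γ Δ φ ψ} → Der σ Φ (Σ' ++ φ ∷ Γ ⇒ Δ) → Der σ Φ (Σ' ++ ψ ∷ Γ ⇒ Δ)
         → Der σ Φ (Σ' ++ (φ ⋁ ψ) ∷ Γ ⇒ Δ)
  ∨R₁  : ∀ {Γ φ ψ} → Der σ Φ (Γ ⇒ just φ) → Der σ Φ (Γ ⇒ just (φ ⋁ ψ))
  ∨R₂  : ∀ {Γ φ ψ} → Der σ Φ (Γ ⇒ just φ) → Der σ Φ (Γ ⇒ just (ψ ⋁ φ))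
  ∧L₁  : ∀ {Σ' Γ Δ φ ψ} → Der σ Φ (Σ' ++ φ ∷ Γ ⇒ Δ) → Der σ Φ (Σ' ++ (φ ⋀ ψ) ∷ Γ ⇒ Δ)
  ∧L₂  : ∀ {Σ' Γ Δ φ ψ} → Der σ Φ (Σ' ++ φ ∷ Γ ⇒ Δ) → Der σ Φ (Σ' ++ (ψ ⋀ φ) ∷ Γ ⇒ Δ)
  ∧R   : ∀ {Γ φ ψ} → Der σ Φ (Γ ⇒ just φ) → Der σ Φ (Γ ⇒ just ψ) → Der σ Φ (Γ ⇒ just (φ ⋀ ψ))
  *L   : ∀ {Σ' Γ Δ φ ψ} → Der σ Φ (Σ' ++ φ ∷ ψ ∷ Γ ⇒ Δ) → Der σ Φ (Σ' ++ (φ ⊛ ψ) ∷ Γ ⇒ Δ)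
  *R   : ∀ {Γ Π φ ψ} → Der σ Φ (Γ ⇒ just φ) → Der σ Φ (Π ⇒ just ψ) → Der σ Φ (Γ ++ Π ⇒ just (φ ⊛ ψ))
  ╲L   : ∀ {Γ Σ' Π Δ φ ψ} → Der σ Φ (Γ ⇒ just φ) → Der σ Φ (Σ' ++ ψ ∷ Π ⇒ Δ)
         → Der σ Φ (Σ' ++ Γ ++ (φ ╲ ψ) ∷ Π ⇒ Δ)
  ╲R   : ∀ {Γ φ ψ} → Der σ Φ (φ ∷ Γ ⇒ just ψ) → Der σ Φ (Γ ⇒ just (φ ╲ ψ))
  /L   : ∀ {Γ Σ' Π Δ φ ψ} → Der σ Φ (Γ ⇒ just φ) → Der σ Φ (Σ' ++ ψ ∷ Π ⇒ Δ)
         → Der σ Φ (Σ' ++ (ψ ╱ φ) ∷ Γ ++ Π ⇒ Δ)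
  /R   : ∀ {Γ φ ψ} → Der σ Φ (Γ ++ φ ∷ [] ⇒ just ψ) → Der σ Φ (Γ ⇒ just (ψ ╱ φ))
  ¬rL  : ∀ {Γ φ} → Der σ Φ (Γ ⇒ just φ) → Der σ Φ (Γ ++ ¬r φ ∷ [] ⇒ nothing)
  ¬rR  : ∀ {Γ φ} → Der σ Φ (φ ∷ Γ ⇒ nothing) → Der σ Φ (Γ ⇒ just (¬r φ))
  ¬lL  : ∀ {Γ φ} → Der σ Φ (Γ ⇒ just φ) → Der σ Φ (¬l φ ∷ Γ ⇒ nothing)
  ¬lR  : ∀ {Γ φ} → Der σ Φ (Γ ++ φ ∷ [] ⇒ nothing) → Der σ Φ (Γ ⇒ just (¬l φ))
  1L   : ∀ {Σ' Γ Δ} → Der σ Φ (Σ' ++ Γ ⇒ Δ) → Der σ Φ (Σ' ++ 𝟙 ∷ Γ ⇒ Δ)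
  0R   : ∀ {Γ} → Der σ Φ (Γ ⇒ nothing) → Der σ Φ (Γ ⇒ just 𝟘)
  exch : ∀ {Γ Π Δ φ ψ} → T (e σ) → Der σ Φ (Γ ++ φ ∷ ψ ∷ Π ⇒ Δ) → Der σ Φ (Γ ++ ψ ∷ φ ∷ Π ⇒ Δ)
  weakl : ∀ {Σ' Γ Δ φ} → T (wl σ) → Der σ Φ (Σ' ++ Γ ⇒ Δ) → Der σ Φ (Σ' ++ φ ∷ Γ ⇒ Δ)
  weakr : ∀ {Γ φ} → T (wr σ) → Der σ Φ (Γ ⇒ nothing) → Der σ Φ (Γ ⇒ just φ)
  contr : ∀ {Σ' Γ Δ φ} → T (c σ) → Der σ Φ (Σ' ++ φ ∷ φ ∷ Γ ⇒ Δ) → Der σ Φ (Σ' ++ φ ∷ Γ ⇒ Δ)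

DerAll : Subseq → (Seq ℕ → Set) → List (Seq ℕ) → Set
DerAll σ Φ L = ∀ {ς} → ς ∈ L → Der σ Φ ς

_⊢e[_]_ : (Fm ℕ → Set) → Subseq → Fm ℕ → Set
Γ ⊢e[ σ ] φ = Der σ (λ ς → Σ (Fm ℕ) (λ ψ → Γ ψ × (ς ≡ ([] ⇒ just ψ)))) ([] ⇒ just φ)

-- Translation schemas.
-- ρ' (formulas → finite sets of sequents): a finite list of sequents in a
-- single variable p (the variable type ⊤); ρ'(φ) substitutes φ for p.
FmToSeqSchema : Set
FmToSeqSchema = List (Seq ⊤)

applyρ : FmToSeqSchema → Fm ℕ → List (Seq ℕ)
applyρ sch φ = map (λ s → substSeq s (λ _ → φ)) sch

applyρSet : FmToSeqSchema → (Fm ℕ → Set) → Seq ℕ → Set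
applyρSet sch Γ ς = Σ (Fm ℕ) (λ ψ → Γ ψ × (ς ∈ applyρ sch ψ))

-- τ' (sequents → finite sets of formulas): for each shape of sequent
-- (n antecedent formulas, empty / nonempty succedent) a finite list of
-- formulas in the variables p₁..pₙ (and q for the succedent, variable zero).
record SeqToFmSchema : Set where
  field
    empty    : (n : ℕ) → List (Fm (Fin n))
    nonempty : (n : ℕ) → List (Fm (Fin (suc n)))
open SeqToFmSchema public

applyτ : SeqToFmSchema → Seq ℕ → List (Fm ℕ)
applyτ sch (Γ ⇒ nothing) = map (_⟪ lookup Γ ⟫) (empty sch (length Γ))
applyτ sch (Γ ⇒ just φ)  = map (_⟪ env ⟫) (nonempty sch (length Γ))
  where
    env : Fin (suc (length Γ)) → Fm ℕ
    env zero    = φ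
    env (suc i) = lookup Γ i

applyρτ : FmToSeqSchema → SeqToFmSchema → Seq ℕ → List (Seq ℕ)
applyρτ r t ς = concatMap (applyρ r) (applyτ t ς)

-- A sequent γ₁ … γₙ ⇒ Δ is interderivable with ∅ ⇒ γₙ╲(…╲(γ₁╲δ)), where δ
-- is the succedent, or 0 if Δ is empty (╲R and ⇒0 one way; ╲L, cut and the
-- axiom 0 ⇒ ∅ the other). So τ'(ς) is this single formula and ρ'(φ) the single
-- sequent ∅ ⇒ φ, under which eFL_σ is literally a fragment of FL_σ. No
-- structural rule is used, so the argument is uniform in σ.
module Submission where

open import Defs
open import Data.Nat using (ℕ; zero; suc)
open import Data.Fin using (Fin; zero; suc)
open import Data.Unit using (tt)
open import Data.Maybe using (Maybe; just; nothing; fromMaybe)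
open import Data.List using (List; []; _∷_; length; lookup)
open import Data.List.Properties using (++-identityʳ)
open import Data.List.Relation.Unary.Any using (here)
open import Data.Product using (Σ; _×_; _,_)
open import Data.List.Membership.Propositional using (_∈_)
open import Relation.Binary.PropositionalEquality using (_≡_; refl; subst; cong)
open import Function.Bundles using (_⇔_; mk⇔)

Der-mono : ∀ {σ} {Φ Ψ : Seq ℕ → Set} → (∀ {ς} → Φ ς → Ψ ς) → ∀ {ς} → Der σ Φ ς → Der σ Ψ ς
Der-mono f ax = ax
Der-mono f ax0 = ax0
Der-mono f ax1 = ax1
Der-mono f (hyp x) = hyp (f x)
Der-mono f (cut {Γ} {S} {P} d e) = cut {Γ = Γ} {Σ' = S} {Π = P} (Der-mono f d) (Der-mono f e)
Der-mono f (∨L {S} {G} d e) = ∨L {Σ' = S} {Γ = G} (Der-mono f d) (Der-mono f e)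
Der-mono f (∨R₁ d) = ∨R₁ (Der-mono f d)
Der-mono f (∨R₂ d) = ∨R₂ (Der-mono f d)
Der-mono f (∧L₁ {S} {G} d) = ∧L₁ {Σ' = S} {Γ = G} (Der-mono f d)
Der-mono f (∧L₂ {S} {G} d) = ∧L₂ {Σ' = S} {Γ = G} (Der-mono f d)
Der-mono f (∧R d e) = ∧R (Der-mono f d) (Der-mono f e)
Der-mono f (*L {S} {G} d) = *L {Σ' = S} {Γ = G} (Der-mono f d)
Der-mono f (*R d e) = *R (Der-mono f d) (Der-mono f e)
Der-mono f (╲L {Γ} {S} {P} d e) = ╲L {Γ = Γ} {Σ' = S} {Π = P} (Der-mono f d) (Der-mono f e)
Der-mono f (╲R d) = ╲R (Der-mono f d)
Der-mono f (/L {Γ} {S} {P} d e) = /L {Γ = Γ} {Σ' = S} {Π = P} (Der-mono f d) (Der-mono f e)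
Der-mono f (/R {Γ} d) = /R {Γ = Γ} (Der-mono f d)
Der-mono f (¬rL d) = ¬rL (Der-mono f d)
Der-mono f (¬rR d) = ¬rR (Der-mono f d)
Der-mono f (¬lL d) = ¬lL (Der-mono f d)
Der-mono f (¬lR {Γ} d) = ¬lR {Γ = Γ} (Der-mono f d)
Der-mono f (1L {S} {G} d) = 1L {Σ' = S} {Γ = G} (Der-mono f d)
Der-mono f (0R d) = 0R (Der-mono f d)
Der-mono f (exch {G} {P} t d) = exch {Γ = G} {Π = P} t (Der-mono f d)
Der-mono f (weakl {S} {G} t d) = weakl {Σ' = S} {Γ = G} t (Der-mono f d)
Der-mono f (weakr t d) = weakr t (Der-mono f d)
Der-mono f (contr {S} {G} t d) = contr {Σ' = S} {Γ = G} t (Der-mono f d)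

-- curry╲ n h φ  is  h (n-1) ╲ (… ╲ (h 0 ╲ φ)).
curry╲ : {V : Set} (n : ℕ) → (Fin n → Fm V) → Fm V → Fm V
curry╲ zero    h φ = φ
curry╲ (suc n) h φ = curry╲ n (λ i → h (suc i)) (h zero ╲ φ)

curry╲-⟪⟫ : {V W : Set} (n : ℕ) (h : Fin n → Fm V) (φ : Fm V) (s : V → Fm W) →
  curry╲ n h φ ⟪ s ⟫ ≡ curry╲ n (λ i → h i ⟪ s ⟫) (φ ⟪ s ⟫)
curry╲-⟪⟫ zero    h φ s = refl
curry╲-⟪⟫ (suc n) h φ s = curry╲-⟪⟫ n (λ i → h (suc i)) (h zero ╲ φ) s

infixr 28 _╲⋆_
_╲⋆_ : {V : Set} → List (Fm V) → Fm V → Fm V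
Γ ╲⋆ φ = curry╲ (length Γ) (lookup Γ) φ

succedent : {V : Set} → Maybe (Fm V) → Fm V
succedent = fromMaybe 𝟘

curried : Seq ℕ → Seq ℕ
curried (Γ ⇒ Δ) = [] ⇒ just (Γ ╲⋆ succedent Δ)

module _ {σ : Subseq} {Φ : Seq ℕ → Set} where

  ╲⋆-intro : ∀ Γ φ → Der σ Φ (Γ ⇒ just φ) → Der σ Φ ([] ⇒ just (Γ ╲⋆ φ))
  ╲⋆-intro []      φ d = d
  ╲⋆-intro (γ ∷ Γ) φ d = ╲⋆-intro Γ (γ ╲ φ) (╲R d)

  ╲-elim : ∀ {Γ γ φ} → Der σ Φ (Γ ⇒ just (γ ╲ φ)) → Der σ Φ (γ ∷ Γ ⇒ just φ)
  ╲-elim {Γ} {γ} {φ} d = subst (λ Γ' → Der σ Φ (γ ∷ Γ' ⇒ just φ)) (++-identityʳ Γ)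
    (cut {Γ = Γ} {Σ' = γ ∷ []} {Π = []} d (╲L {Γ = γ ∷ []} {Σ' = []} {Π = []} ax ax))

  ╲⋆-elim : ∀ Γ φ → Der σ Φ ([] ⇒ just (Γ ╲⋆ φ)) → Der σ Φ (Γ ⇒ just φ)
  ╲⋆-elim []      φ d = d
  ╲⋆-elim (γ ∷ Γ) φ d = ╲-elim (╲⋆-elim Γ (γ ╲ φ) d)

  succedent-intro : ∀ {Γ} Δ → Der σ Φ (Γ ⇒ Δ) → Der σ Φ (Γ ⇒ just (succedent Δ))
  succedent-intro nothing  d = 0R d
  succedent-intro (just φ) d = d

  succedent-elim : ∀ {Γ} Δ → Der σ Φ (Γ ⇒ just (succedent Δ)) → Der σ Φ (Γ ⇒ Δ)
  succedent-elim {Γ} nothing d = subst (λ Γ' → Der σ Φ (Γ' ⇒ nothing)) (++-identityʳ Γ)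
    (cut {Γ = Γ} {Σ' = []} {Π = []} d ax0)
  succedent-elim (just φ) d = d

  curried-intro : ∀ ς → Der σ Φ ς → Der σ Φ (curried ς)
  curried-intro (Γ ⇒ Δ) d = ╲⋆-intro Γ (succedent Δ) (succedent-intro Δ d)

  curried-elim : ∀ ς → Der σ Φ (curried ς) → Der σ Φ ς
  curried-elim (Γ ⇒ Δ) d = succedent-elim Δ (╲⋆-elim Γ (succedent Δ) d)

curriedSchema : SeqToFmSchema
curriedSchema = record
  { empty    = λ n → curry╲ n var 𝟘 ∷ []
  ; nonempty = λ n → curry╲ n (λ i → var (suc i)) (var zero) ∷ []
  }

provabilitySchema : FmToSeqSchema
provabilitySchema = ([] ⇒ just (var tt)) ∷ []

applyρτ-curried : ∀ ς → applyρτ provabilitySchema curriedSchema ς ≡ curried ς ∷ []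
applyρτ-curried (Γ ⇒ nothing) =
  cong (λ φ → ([] ⇒ just φ) ∷ []) (curry╲-⟪⟫ (length Γ) var 𝟘 (lookup Γ))
applyρτ-curried (Γ ⇒ just φ)  =
  cong (λ ψ → ([] ⇒ just ψ) ∷ []) (curry╲-⟪⟫ (length Γ) (λ i → var (suc i)) (var zero) _)

theorem26 : (σ : Subseq) →
    Σ SeqToFmSchema λ τ' → Σ FmToSeqSchema λ ρ' →
      ((Γ : Fm ℕ → Set) (φ : Fm ℕ) →
         (Γ ⊢e[ σ ] φ) ⇔ DerAll σ (applyρSet ρ' Γ) (applyρ ρ' φ))
      × ((ς : Seq ℕ) →
           DerAll σ (λ x → x ≡ ς) (applyρτ ρ' τ' ς)
           × Der σ (λ x → x ∈ applyρτ ρ' τ' ς) ς)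
theorem26 σ = curriedSchema , provabilitySchema , external , interderivable
  where
  external : (Γ : Fm ℕ → Set) (φ : Fm ℕ) →
    (Γ ⊢e[ σ ] φ) ⇔ DerAll σ (applyρSet provabilitySchema Γ) (applyρ provabilitySchema φ)
  external Γ φ = mk⇔
    (λ { d (here refl) → Der-mono (λ { (ψ , γ , refl) → ψ , γ , here refl }) d })
    (λ D → Der-mono (λ { (ψ , γ , here refl) → ψ , γ , refl }) (D (here refl)))

  interderivable : (ς : Seq ℕ) →
    DerAll σ (λ x → x ≡ ς) (applyρτ provabilitySchema curriedSchema ς)
    × Der σ (λ x → x ∈ applyρτ provabilitySchema curriedSchema ς) ς
  interderivable ς rewrite applyρτ-curried ς =
    (λ { (here refl) → curried-intro ς (hyp refl) }) ,
    curried-elim ς (hyp (here refl))
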